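{- Let $N_1$ be a positive rational number and let $(X_1,Y_1)$ and $(Z_1,W_1)$ be rational points on the curve $C_{N_1}: y^2=x^3-N_1^2x$ with $Y_1\neq 0$, $W_1\neq 0$, $X_1\neq Z_1$, and such that $X_1Z_1$ is the square of a rational number; let $\sqrt{X_1Z_1}$ denote its positive square root. (i) For every positive rational number $d_s'$, the numbers $$a'=\frac{|Y_1W_1|}{(X_1Z_1+N_1^2)\sqrt{X_1Z_1}}\,d_s',\quad b'=\Big|\frac{N_1(Z_1-X_1)}{X_1Z_1-N_1^2}\Big|\,d_s',\quad c'=\Big|\frac{2N_1Y_1W_1}{X_1^2Z_1^2-N_1^4}\Big|\,d_s',$$ $$d_{ac}'=\Big|\frac{Y_1W_1}{(X_1Z_1-N_1^2)\sqrt{X_1Z_1}}\Big|\,d_s',\quad d_{bc}'=\frac{|N_1(X_1+Z_1)|}{X_1Z_1+N_1^2}\,d_s'$$ are positive rational numbers and $(a',b',c',d_{bc}',d_{ac}',d_s')$ is a nearly-perfect cuboid; its face diagonal $d_{ab}'=\sqrt{a'^2+b'^2}$ equals $\sqrt{1-\Big(\frac{2N_1Y_1W_1}{X_1^2Z_1^2-N_1^4}\Big)^2}\cdot d_s'$. (ii) Conversely, every nearly-perfect cuboid is obtained in this way for some such $N_1$, $(X_1,Y_1)$, $(Z_1,W_1)$ and $d_s'$. (iii) In particular, a perfect cuboid exists if and only if for some such data the number $\sqrt{1-\Big(\frac{2N_1Y_1W_1}{X_1^2Z_1^2-N_1^4}\Big)^2}\cdot d_s'$ is rational.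
   Context: For a nonzero rational $N$, the congruent number curve is $C_N: y^2=x^3-N^2x$; a rational point $(x,y)$ on it is called nontrivial if $y\neq 0$. A nearly-perfect cuboid (NPC) here means a sextuple of positive rational numbers $(a,b,c,d_{bc},d_{ac},d_s)$ with $b^2+c^2=d_{bc}^2$, $a^2+c^2=d_{ac}^2$, $a^2+b^2+c^2=d_s^2$ (the remaining face diagonal $d_{ab}=\sqrt{a^2+b^2}$ may be irrational). A perfect cuboid is a triple of positive rationals $a,b,c$ such that $a^2+b^2$, $b^2+c^2$, $a^2+c^2$ and $a^2+b^2+c^2$ are all squares of rational numbers. -}

module Defs where

open import Data.Rational using (ℚ; 0ℚ; 1ℚ; _+_; _*_; _-_; ∣_∣; _<_; _≤_; 1/_; ≢-nonZero)
open import Data.Rational.Properties using (_≟_)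
open import Data.Product using (Σ; ∃; _×_)
open import Relation.Nullary using (yes; no)
open import Relation.Binary.PropositionalEquality using (_≡_; _≢_)

-- Total reciprocal: inv p = 1/p for p ≠ 0, and (by convention) 0 for p = 0.
-- All uses below occur at provably nonzero denominators under the hypotheses.
inv : ℚ → ℚ
inv p with p ≟ 0ℚ
... | yes _  = 0ℚ
... | no p≢0 = 1/_ p {{≢-nonZero p≢0}}

_÷'_ : ℚ → ℚ → ℚ
p ÷' q = p * inv q

infixl 7 _÷'_

OnCurve : ℚ → ℚ → ℚ → Set
OnCurve N x y = y * y ≡ x * x * x - N * N * x

record Admissible (N X Y Z W s : ℚ) : Set where
  field
    N-pos   : 0ℚ < N
    onCurve₁ : OnCurve N X Y
    onCurve₂ : OnCurve N Z W
    Y≢0     : Y ≢ 0ℚ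
    W≢0     : W ≢ 0ℚ
    X≢Z     : X ≢ Z
    s-pos   : 0ℚ < s
    s-sq    : s * s ≡ X * Z

record NPC (a b c dbc dac ds : ℚ) : Set where
  field
    a-pos   : 0ℚ < a
    b-pos   : 0ℚ < b
    c-pos   : 0ℚ < c
    dbc-pos : 0ℚ < dbc
    dac-pos : 0ℚ < dac
    ds-pos  : 0ℚ < ds
    eq-bc   : b * b + c * c ≡ dbc * dbc
    eq-ac   : a * a + c * c ≡ dac * dac
    eq-s    : a * a + b * b + c * c ≡ ds * ds

IsSquare : ℚ → Set
IsSquare q = ∃ λ r → r * r ≡ q

PerfectCuboid : ℚ → ℚ → ℚ → Set
PerfectCuboid a b c =
  (0ℚ < a) × (0ℚ < b) × (0ℚ < c) ×
  IsSquare (a * a + b * b) × IsSquare (b * b + c * c) ×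
  IsSquare (a * a + c * c) × IsSquare (a * a + b * b + c * c)

a′ : ℚ → ℚ → ℚ → ℚ → ℚ → ℚ → ℚ → ℚ
a′ N X Y Z W s d = (∣ Y * W ∣ ÷' ((X * Z + N * N) * s)) * d

b′ : ℚ → ℚ → ℚ → ℚ → ℚ → ℚ → ℚ → ℚ
b′ N X Y Z W s d = ∣ (N * (Z - X)) ÷' (X * Z - N * N) ∣ * d

q′ : ℚ → ℚ → ℚ → ℚ → ℚ → ℚ
q′ N X Y Z W = ((1ℚ + 1ℚ) * N * Y * W) ÷' (X * X * Z * Z - N * N * N * N)

c′ : ℚ → ℚ → ℚ → ℚ → ℚ → ℚ → ℚ → ℚ
c′ N X Y Z W s d = ∣ q′ N X Y Z W ∣ * d

dac′ : ℚ → ℚ → ℚ → ℚ → ℚ → ℚ → ℚ → ℚ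
dac′ N X Y Z W s d = ∣ (Y * W) ÷' ((X * Z - N * N) * s) ∣ * d

dbc′ : ℚ → ℚ → ℚ → ℚ → ℚ → ℚ → ℚ → ℚ
dbc′ N X Y Z W s d = (∣ N * (X + Z) ∣ ÷' (X * Z + N * N)) * d

{-# OPTIONS --safe #-}
-- Put P = XZ + N², M = XZ − N² and s² = XZ. Multiplying the two curve equations gives
--   (YW)² = XZ (X² − N²)(Z² − N²) = s² (P² − N²(X + Z)²) = s² (M² − N²(X − Z)²),
-- so the ratios a = |YW|/(Ps), d_bc = N|X + Z|/P, b = N|Z − X|/|M|, d_ac = |YW|/|Ms|
-- satisfy a² + d_bc² = 1 = b² + d_ac², and c = 2N|YW|/|MP| satisfies a² + c² = d_ac²
-- because P² − M² = 4N²s². These are the equations of a nearly-perfect cuboid with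
-- d_s = 1; scaling by d gives (i).
-- Conversely, a nearly-perfect cuboid contains the right triangles (a, c, d_ac) and
-- (ab, c d_s, d_bc d_ac), the second because (a² + c²)(b² + c²) = a²b² + c² d_s².
-- With A = d_ac + a and B = d_bc d_ac + ab (so c/A and c d_s/B are their half-angle
-- tangents) and μ = 2a d_ac B (b + d_bc), the points X = μAB² and Z = μA c² d_s² lie
-- on C_N for N = μ c² d_s B, and the formulas of (i) recover the cuboid.
-- Part (iii) follows since d_ab² = a² + b².
module Submission where

open import Defs
open import Data.Rational using (ℚ; 0ℚ; 1ℚ; _+_; _*_; _-_; -_; _<_; _≤_; ∣_∣; ≢-nonZero; positive; nonNegative)
open import Data.Rational.Properties
open import Data.List using (_∷_; [])
open import Data.Maybe using (Maybe; just; nothing)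
open import Data.Sum using (inj₁; inj₂)
open import Data.Product using (∃; _×_; _,_; proj₁; proj₂)
open import Function.Bundles using (_⇔_; mk⇔)
open import Relation.Nullary using (yes; no; contradiction)
open import Relation.Binary.PropositionalEquality using (_≡_; _≢_; refl; sym; trans; cong; cong₂; subst; module ≡-Reasoning)
open import Algebra.Properties.Group +-0-group using () renaming (∙-cancelʳ to +-cancelʳ)
open import Tactic.RingSolver using (solve)
open import Tactic.RingSolver.Core.AlmostCommutativeRing using (AlmostCommutativeRing; fromCommutativeRing)

open ≡-Reasoning

ℚ-ring : AlmostCommutativeRing _ _
ℚ-ring = fromCommutativeRing +-*-commutativeRing isZero
  where
  isZero : (x : ℚ) → Maybe (0ℚ ≡ x)
  isZero x with x ≟ 0ℚ
  ... | yes x≡0 = just (sym x≡0)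
  ... | no _    = nothing

2ℚ : ℚ
2ℚ = 1ℚ + 1ℚ

-- Signs and the total division

pos⇒≢0 : ∀ {x} → 0ℚ < x → x ≢ 0ℚ
pos⇒≢0 x>0 x≡0 = <⇒≢ x>0 (sym x≡0)

*-pos : ∀ {x y} → 0ℚ < x → 0ℚ < y → 0ℚ < x * y
*-pos {x} {y} x>0 y>0 = positive⁻¹ _ {{pos*pos⇒pos x {{positive x>0}} y {{positive y>0}}}}

+-pos : ∀ {x y} → 0ℚ < x → 0ℚ < y → 0ℚ < x + y
+-pos {x} {y} x>0 y>0 = positive⁻¹ _ {{pos+pos⇒pos x {{positive x>0}} y {{positive y>0}}}}

+-pos-nonneg : ∀ {x y} → 0ℚ < x → 0ℚ ≤ y → 0ℚ < x + y
+-pos-nonneg {x} {y} x>0 y≥0 = positive⁻¹ _ {{pos+nonNeg⇒pos x {{positive x>0}} y {{nonNegative y≥0}}}}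

+-nonneg-pos : ∀ {x y} → 0ℚ ≤ x → 0ℚ < y → 0ℚ < x + y
+-nonneg-pos {x} {y} x≥0 y>0 = positive⁻¹ _ {{nonNeg+pos⇒pos x {{nonNegative x≥0}} y {{positive y>0}}}}

∣∣-pos : ∀ {x} → x ≢ 0ℚ → 0ℚ < ∣ x ∣
∣∣-pos {x} x≢0 = positive⁻¹ _ {{nonNeg∧nonZero⇒pos (∣ x ∣) {{∣-∣-nonNeg x}} {{≢-nonZero ∣x∣≢0}}}}
  where
  ∣x∣≢0 : ∣ x ∣ ≢ 0ℚ
  ∣x∣≢0 ∣x∣≡0 = x≢0 (∣p∣≡0⇒p≡0 x ∣x∣≡0)

∣∣-sq : ∀ x → ∣ x ∣ * ∣ x ∣ ≡ x * x
∣∣-sq x with ∣p∣≡p∨∣p∣≡-p x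
... | inj₁ ∣x∣≡x  = cong₂ _*_ ∣x∣≡x ∣x∣≡x
... | inj₂ ∣x∣≡-x = trans (cong₂ _*_ ∣x∣≡-x ∣x∣≡-x) (solve (x ∷ []) ℚ-ring)

square-pos : ∀ {x} → x ≢ 0ℚ → 0ℚ < x * x
square-pos {x} x≢0 = subst (0ℚ <_) (∣∣-sq x) (*-pos (∣∣-pos x≢0) (∣∣-pos x≢0))

*-nonneg : ∀ {x y} → 0ℚ ≤ x → 0ℚ ≤ y → 0ℚ ≤ x * y
*-nonneg {x} {y} x≥0 y≥0 = nonNegative⁻¹ _ {{nonNeg*nonNeg⇒nonNeg x {{nonNegative x≥0}} y {{nonNegative y≥0}}}}

square-nonneg : ∀ x → 0ℚ ≤ x * x
square-nonneg x = subst (0ℚ ≤_) (∣∣-sq x) (*-nonneg (0≤∣p∣ x) (0≤∣p∣ x))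

p-q≡0⇒p≡q : ∀ {p q} → p - q ≡ 0ℚ → p ≡ q
p-q≡0⇒p≡q {p} {q} p-q≡0 = begin
  p              ≡⟨ solve (p ∷ q ∷ []) ℚ-ring ⟩
  (p - q) + q    ≡⟨ cong (_+ q) p-q≡0 ⟩
  0ℚ + q         ≡⟨ +-identityˡ q ⟩
  q              ∎

2≢0 : 2ℚ ≢ 0ℚ
2≢0 ()

2>0 : 0ℚ < 2ℚ
2>0 = positive⁻¹ 2ℚ

pos⇒∣p∣≡p : ∀ {p} → 0ℚ < p → ∣ p ∣ ≡ p
pos⇒∣p∣≡p p>0 = 0≤p⇒∣p∣≡p (<⇒≤ p>0)

inv-inverseˡ : ∀ {p} → p ≢ 0ℚ → inv p * p ≡ 1ℚ
inv-inverseˡ {p} p≢0 with p ≟ 0ℚ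
... | yes p≡0  = contradiction p≡0 p≢0
... | no  p≢0′ = *-inverseˡ p {{≢-nonZero p≢0′}}

inv-pos : ∀ {p} → 0ℚ < p → 0ℚ < inv p
inv-pos {p} p>0 with p ≟ 0ℚ
... | yes p≡0 = contradiction p≡0 (pos⇒≢0 p>0)
... | no  _   = positive⁻¹ _ {{1/pos⇒pos p {{positive p>0}}}}

÷'-cancelʳ : ∀ {x D} → D ≢ 0ℚ → (x ÷' D) * D ≡ x
÷'-cancelʳ {x} {D} D≢0 = begin
  x * inv D * D    ≡⟨ *-assoc x (inv D) D ⟩
  x * (inv D * D)  ≡⟨ cong (x *_) (inv-inverseˡ D≢0) ⟩
  x * 1ℚ           ≡⟨ *-identityʳ x ⟩
  x                ∎

*-÷'-cancel : ∀ {x D} → D ≢ 0ℚ → (x * D) ÷' D ≡ x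
*-÷'-cancel {x} {D} D≢0 = begin
  x * D * inv D    ≡⟨ *-assoc x D (inv D) ⟩
  x * (D * inv D)  ≡⟨ cong (x *_) (trans (*-comm D (inv D)) (inv-inverseˡ D≢0)) ⟩
  x * 1ℚ           ≡⟨ *-identityʳ x ⟩
  x                ∎

*-cancelʳ-≡ : ∀ {x y K} → K ≢ 0ℚ → x * K ≡ y * K → x ≡ y
*-cancelʳ-≡ {x} {y} {K} K≢0 xK≡yK = begin
  x              ≡⟨ sym (*-÷'-cancel K≢0) ⟩
  (x * K) ÷' K   ≡⟨ cong (_÷' K) xK≡yK ⟩
  (y * K) ÷' K   ≡⟨ *-÷'-cancel K≢0 ⟩
  y              ∎

*-≢0 : ∀ {x y} → x ≢ 0ℚ → y ≢ 0ℚ → x * y ≢ 0ℚ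
*-≢0 {x} {y} x≢0 y≢0 xy≡0 = x≢0 (begin
  x             ≡⟨ sym (*-÷'-cancel y≢0) ⟩
  (x * y) ÷' y  ≡⟨ cong (_÷' y) xy≡0 ⟩
  0ℚ * inv y    ≡⟨ *-zeroˡ (inv y) ⟩
  0ℚ            ∎)

÷'-pos : ∀ {x D} → 0ℚ < x → 0ℚ < D → 0ℚ < x ÷' D
÷'-pos x>0 D>0 = *-pos x>0 (inv-pos D>0)

∣÷'∣-pos : ∀ {x D} → x ≢ 0ℚ → D ≢ 0ℚ → 0ℚ < ∣ x ÷' D ∣
∣÷'∣-pos {x} {D} x≢0 D≢0 = ∣∣-pos λ x÷D≡0 → x≢0 (begin
  x             ≡⟨ sym (÷'-cancelʳ D≢0) ⟩
  (x ÷' D) * D  ≡⟨ cong (_* D) x÷D≡0 ⟩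
  0ℚ * D        ≡⟨ *-zeroˡ D ⟩
  0ℚ            ∎)

÷'-scale : ∀ {x D a g} → D ≢ 0ℚ → a * D ≡ x * g → (x ÷' D) * g ≡ a
÷'-scale {x} {D} {a} {g} D≢0 aD≡xg = *-cancelʳ-≡ {(x ÷' D) * g} {a} D≢0 (begin
  (x ÷' D) * g * D    ≡⟨ *-assoc (x ÷' D) g D ⟩
  (x ÷' D) * (g * D)  ≡⟨ cong ((x ÷' D) *_) (*-comm g D) ⟩
  (x ÷' D) * (D * g)  ≡⟨ sym (*-assoc (x ÷' D) D g) ⟩
  (x ÷' D) * D * g    ≡⟨ cong (_* g) (÷'-cancelʳ {x} D≢0) ⟩
  x * g               ≡⟨ sym aD≡xg ⟩
  a * D               ∎)

∣÷'∣-scale : ∀ {x D a g} → D ≢ 0ℚ → 0ℚ ≤ g → a * D ≡ x * g → ∣ x ÷' D ∣ * g ≡ ∣ a ∣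
∣÷'∣-scale {x} {D} {a} {g} D≢0 g≥0 aD≡xg = begin
  ∣ x ÷' D ∣ * g        ≡⟨ cong (∣ x ÷' D ∣ *_) (sym (0≤p⇒∣p∣≡p g≥0)) ⟩
  ∣ x ÷' D ∣ * ∣ g ∣    ≡⟨ sym (∣p*q∣≡∣p∣*∣q∣ (x ÷' D) g) ⟩
  ∣ (x ÷' D) * g ∣      ≡⟨ cong ∣_∣ (÷'-scale {x} D≢0 aD≡xg) ⟩
  ∣ a ∣                 ∎

square-scale : ∀ {v D x} → v * D ≡ x → v * v * (D * D) ≡ x * x
square-scale {v} {D} {x} vD≡x = begin
  v * v * (D * D)    ≡⟨ solve (v ∷ D ∷ []) ℚ-ring ⟩
  (v * D) * (v * D)  ≡⟨ cong₂ _*_ vD≡x vD≡x ⟩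
  x * x              ∎

∣∣÷'-square : ∀ {x D} → D ≢ 0ℚ → (∣ x ∣ ÷' D) * (∣ x ∣ ÷' D) * (D * D) ≡ x * x
∣∣÷'-square {x} {D} D≢0 = trans (square-scale {∣ x ∣ ÷' D} (÷'-cancelʳ {∣ x ∣} D≢0)) (∣∣-sq x)

∣÷'∣-square : ∀ {x D} → D ≢ 0ℚ → ∣ x ÷' D ∣ * ∣ x ÷' D ∣ * (D * D) ≡ x * x
∣÷'∣-square {x} {D} D≢0 = trans (cong (_* (D * D)) (∣∣-sq (x ÷' D))) (square-scale {x ÷' D} (÷'-cancelʳ {x} D≢0))

-- From two points of a congruent number curve to a cuboid

curve-product : ∀ {N X Y Z W} → OnCurve N X Y → OnCurve N Z W →
                (Y * W) * (Y * W) ≡ X * Z * ((X * X - N * N) * (Z * Z - N * N))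
curve-product {N} {X} {Y} {Z} {W} onX onZ = begin
  (Y * W) * (Y * W)                          ≡⟨ solve (Y ∷ W ∷ []) ℚ-ring ⟩
  (Y * Y) * (W * W)                          ≡⟨ cong₂ _*_ onX onZ ⟩
  (X * X * X - N * N * X) * (Z * Z * Z - N * N * Z)  ≡⟨ solve (N ∷ X ∷ Z ∷ []) ℚ-ring ⟩
  X * Z * ((X * X - N * N) * (Z * Z - N * N)) ∎

difference-of-fourth-powers : ∀ N X Z → X * X * Z * Z - N * N * N * N ≡ (X * Z - N * N) * (X * Z + N * N)
difference-of-fourth-powers N X Z = solve (N ∷ X ∷ Z ∷ []) ℚ-ring

unit-cuboid-equations : ∀ {a b c dbc dac} →
  a * a + dbc * dbc ≡ 1ℚ → b * b + dac * dac ≡ 1ℚ → a * a + c * c ≡ dac * dac →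
  (b * b + c * c ≡ dbc * dbc) × (a * a + b * b + c * c ≡ 1ℚ * 1ℚ)
unit-cuboid-equations {a} {b} {c} {dbc} {dac} a²+dbc²≡1 b²+dac²≡1 a²+c²≡dac² = eq-bc , eq-s
  where
  b²+a²+c²≡1 : b * b + (a * a + c * c) ≡ 1ℚ
  b²+a²+c²≡1 = trans (cong (b * b +_) a²+c²≡dac²) b²+dac²≡1

  eq-bc : b * b + c * c ≡ dbc * dbc
  eq-bc = +-cancelʳ (a * a) _ _ (begin
    (b * b + c * c) + a * a   ≡⟨ solve (a ∷ b ∷ c ∷ []) ℚ-ring ⟩
    b * b + (a * a + c * c)   ≡⟨ b²+a²+c²≡1 ⟩
    1ℚ                        ≡⟨ sym a²+dbc²≡1 ⟩
    a * a + dbc * dbc         ≡⟨ +-comm (a * a) (dbc * dbc) ⟩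
    dbc * dbc + a * a         ∎)

  eq-s : a * a + b * b + c * c ≡ 1ℚ * 1ℚ
  eq-s = begin
    a * a + b * b + c * c     ≡⟨ solve (a ∷ b ∷ c ∷ []) ℚ-ring ⟩
    b * b + (a * a + c * c)   ≡⟨ b²+a²+c²≡1 ⟩
    1ℚ                        ≡⟨ sym (*-identityˡ 1ℚ) ⟩
    1ℚ * 1ℚ                   ∎

squares-scale₂ : ∀ {x y z} d → x * x + y * y ≡ z * z → (x * d) * (x * d) + (y * d) * (y * d) ≡ (z * d) * (z * d)
squares-scale₂ {x} {y} {z} d x²+y²≡z² = begin
  (x * d) * (x * d) + (y * d) * (y * d)  ≡⟨ solve (x ∷ y ∷ d ∷ []) ℚ-ring ⟩
  (x * x + y * y) * (d * d)              ≡⟨ cong (_* (d * d)) x²+y²≡z² ⟩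
  z * z * (d * d)                        ≡⟨ solve (z ∷ d ∷ []) ℚ-ring ⟩
  (z * d) * (z * d)                      ∎

squares-scale₃ : ∀ {x y z w} d → x * x + y * y + z * z ≡ w * w →
                 (x * d) * (x * d) + (y * d) * (y * d) + (z * d) * (z * d) ≡ (w * d) * (w * d)
squares-scale₃ {x} {y} {z} {w} d x²+y²+z²≡w² = begin
  (x * d) * (x * d) + (y * d) * (y * d) + (z * d) * (z * d)  ≡⟨ solve (x ∷ y ∷ z ∷ d ∷ []) ℚ-ring ⟩
  (x * x + y * y + z * z) * (d * d)                          ≡⟨ cong (_* (d * d)) x²+y²+z²≡w² ⟩
  w * w * (d * d)                                            ≡⟨ solve (w ∷ d ∷ []) ℚ-ring ⟩
  (w * d) * (w * d)                                          ∎

NPC-scale : ∀ {a b c dbc dac ds} d → NPC a b c dbc dac ds → 0ℚ < d →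
            NPC (a * d) (b * d) (c * d) (dbc * d) (dac * d) (ds * d)
NPC-scale {a} {b} {c} {dbc} {dac} {ds} d npc d>0 = record
  { a-pos   = *-pos a-pos d>0
  ; b-pos   = *-pos b-pos d>0
  ; c-pos   = *-pos c-pos d>0
  ; dbc-pos = *-pos dbc-pos d>0
  ; dac-pos = *-pos dac-pos d>0
  ; ds-pos  = *-pos ds-pos d>0
  ; eq-bc   = squares-scale₂ {b} {c} {dbc} d eq-bc
  ; eq-ac   = squares-scale₂ {a} {c} {dac} d eq-ac
  ; eq-s    = squares-scale₃ {a} {b} {c} {ds} d eq-s
  }
  where open NPC npc

face-diagonal : ∀ {x y z} d → x * x + y * y + z * z ≡ 1ℚ * 1ℚ →
                (x * d) * (x * d) + (y * d) * (y * d) ≡ (1ℚ - z * z) * (d * d)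
face-diagonal {x} {y} {z} d x²+y²+z²≡1 = begin
  (x * d) * (x * d) + (y * d) * (y * d)        ≡⟨ solve (x ∷ y ∷ z ∷ d ∷ []) ℚ-ring ⟩
  (x * x + y * y + z * z - z * z) * (d * d)    ≡⟨ cong (λ t → (t - z * z) * (d * d)) x²+y²+z²≡1 ⟩
  (1ℚ * 1ℚ - z * z) * (d * d)                  ≡⟨ cong (λ t → (t - z * z) * (d * d)) (*-identityˡ 1ℚ) ⟩
  (1ℚ - z * z) * (d * d)                       ∎

X²Z²-N⁴≢0 : ∀ {N X Z} → X * Z - N * N ≢ 0ℚ → X * Z + N * N ≢ 0ℚ → X * X * Z * Z - N * N * N * N ≢ 0ℚ
X²Z²-N⁴≢0 {N} {X} {Z} M≢0 P≢0 = subst (_≢ 0ℚ) (sym (difference-of-fourth-powers N X Z)) (*-≢0 M≢0 P≢0)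

module FromCurvePoints {N X Y Z W s : ℚ} (adm : Admissible N X Y Z W s) where
  open Admissible adm

  YW-sum₊ : (Y * W) * (Y * W) + (N * (X + Z)) * (N * (X + Z)) * (s * s)
            ≡ ((X * Z + N * N) * s) * ((X * Z + N * N) * s)
  YW-sum₊ = begin
    (Y * W) * (Y * W) + (N * (X + Z)) * (N * (X + Z)) * (s * s)
      ≡⟨ cong (_+ (N * (X + Z)) * (N * (X + Z)) * (s * s)) (curve-product {N} {X} {Y} {Z} {W} onCurve₁ onCurve₂) ⟩
    X * Z * ((X * X - N * N) * (Z * Z - N * N)) + (N * (X + Z)) * (N * (X + Z)) * (s * s)
      ≡⟨ cong (λ t → X * Z * ((X * X - N * N) * (Z * Z - N * N)) + (N * (X + Z)) * (N * (X + Z)) * t) s-sq ⟩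
    X * Z * ((X * X - N * N) * (Z * Z - N * N)) + (N * (X + Z)) * (N * (X + Z)) * (X * Z)
      ≡⟨ solve (N ∷ X ∷ Z ∷ []) ℚ-ring ⟩
    (X * Z + N * N) * (X * Z + N * N) * (X * Z)
      ≡⟨ cong ((X * Z + N * N) * (X * Z + N * N) *_) (sym s-sq) ⟩
    (X * Z + N * N) * (X * Z + N * N) * (s * s)
      ≡⟨ solve (N ∷ X ∷ Z ∷ s ∷ []) ℚ-ring ⟩
    ((X * Z + N * N) * s) * ((X * Z + N * N) * s) ∎

  YW-sum₋ : (Y * W) * (Y * W) + (N * (Z - X)) * (N * (Z - X)) * (s * s)
            ≡ ((X * Z - N * N) * s) * ((X * Z - N * N) * s)
  YW-sum₋ = begin
    (Y * W) * (Y * W) + (N * (Z - X)) * (N * (Z - X)) * (s * s)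
      ≡⟨ cong (_+ (N * (Z - X)) * (N * (Z - X)) * (s * s)) (curve-product {N} {X} {Y} {Z} {W} onCurve₁ onCurve₂) ⟩
    X * Z * ((X * X - N * N) * (Z * Z - N * N)) + (N * (Z - X)) * (N * (Z - X)) * (s * s)
      ≡⟨ cong (λ t → X * Z * ((X * X - N * N) * (Z * Z - N * N)) + (N * (Z - X)) * (N * (Z - X)) * t) s-sq ⟩
    X * Z * ((X * X - N * N) * (Z * Z - N * N)) + (N * (Z - X)) * (N * (Z - X)) * (X * Z)
      ≡⟨ solve (N ∷ X ∷ Z ∷ []) ℚ-ring ⟩
    (X * Z - N * N) * (X * Z - N * N) * (X * Z)
      ≡⟨ cong ((X * Z - N * N) * (X * Z - N * N) *_) (sym s-sq) ⟩
    (X * Z - N * N) * (X * Z - N * N) * (s * s)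
      ≡⟨ solve (N ∷ X ∷ Z ∷ s ∷ []) ℚ-ring ⟩
    ((X * Z - N * N) * s) * ((X * Z - N * N) * s) ∎

  N≢0 : N ≢ 0ℚ
  N≢0 = pos⇒≢0 N-pos

  s≢0 : s ≢ 0ℚ
  s≢0 = pos⇒≢0 s-pos

  YW≢0 : Y * W ≢ 0ℚ
  YW≢0 = *-≢0 Y≢0 W≢0

  XZ>0 : 0ℚ < X * Z
  XZ>0 = subst (0ℚ <_) s-sq (*-pos s-pos s-pos)

  XZ+N²>0 : 0ℚ < X * Z + N * N
  XZ+N²>0 = +-pos XZ>0 (*-pos N-pos N-pos)

  XZ+N²≢0 : X * Z + N * N ≢ 0ℚ
  XZ+N²≢0 = pos⇒≢0 XZ+N²>0

  XZ-N²≢0 : X * Z - N * N ≢ 0ℚ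
  XZ-N²≢0 M≡0 = pos⇒≢0 [Ms]²>0 (begin
    ((X * Z - N * N) * s) * ((X * Z - N * N) * s)  ≡⟨ cong (λ t → (t * s) * (t * s)) M≡0 ⟩
    (0ℚ * s) * (0ℚ * s)                          ≡⟨ solve (s ∷ []) ℚ-ring ⟩
    0ℚ                                           ∎)
    where
    [Ms]²>0 : 0ℚ < ((X * Z - N * N) * s) * ((X * Z - N * N) * s)
    [Ms]²>0 = subst (0ℚ <_) YW-sum₋ (+-pos-nonneg (square-pos YW≢0) (*-nonneg (square-nonneg (N * (Z - X))) (square-nonneg s)))

  Ps≢0 : (X * Z + N * N) * s ≢ 0ℚ
  Ps≢0 = *-≢0 XZ+N²≢0 s≢0

  Ms≢0 : (X * Z - N * N) * s ≢ 0ℚ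
  Ms≢0 = *-≢0 XZ-N²≢0 s≢0

  X+Z≢0 : X + Z ≢ 0ℚ
  X+Z≢0 X+Z≡0 = pos⇒≢0 X[X+Z]>0 (trans (cong (X *_) X+Z≡0) (*-zeroʳ X))
    where
    X[X+Z]>0 : 0ℚ < X * (X + Z)
    X[X+Z]>0 = subst (0ℚ <_) X²+s²≡X[X+Z] (+-nonneg-pos (square-nonneg X) (*-pos s-pos s-pos))
      where
      X²+s²≡X[X+Z] : X * X + s * s ≡ X * (X + Z)
      X²+s²≡X[X+Z] = begin
        X * X + s * s  ≡⟨ cong (X * X +_) s-sq ⟩
        X * X + X * Z  ≡⟨ solve (X ∷ Z ∷ []) ℚ-ring ⟩
        X * (X + Z)    ∎

  a₁²+dbc₁²≡1 : ∀ {a₁ dbc₁} →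
    a₁ * a₁ * (((X * Z + N * N) * s) * ((X * Z + N * N) * s)) ≡ (Y * W) * (Y * W) →
    dbc₁ * dbc₁ * ((X * Z + N * N) * (X * Z + N * N)) ≡ (N * (X + Z)) * (N * (X + Z)) →
    a₁ * a₁ + dbc₁ * dbc₁ ≡ 1ℚ
  a₁²+dbc₁²≡1 {a₁} {dbc₁} ha hdbc = *-cancelʳ-≡ (*-≢0 Ps≢0 Ps≢0) (begin
    (a₁ * a₁ + dbc₁ * dbc₁) * (((X * Z + N * N) * s) * ((X * Z + N * N) * s))
      ≡⟨ solve (N ∷ X ∷ Z ∷ s ∷ a₁ ∷ dbc₁ ∷ []) ℚ-ring ⟩
    a₁ * a₁ * (((X * Z + N * N) * s) * ((X * Z + N * N) * s))
      + dbc₁ * dbc₁ * ((X * Z + N * N) * (X * Z + N * N)) * (s * s)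
      ≡⟨ cong₂ _+_ ha (cong (_* (s * s)) hdbc) ⟩
    (Y * W) * (Y * W) + (N * (X + Z)) * (N * (X + Z)) * (s * s)
      ≡⟨ YW-sum₊ ⟩
    ((X * Z + N * N) * s) * ((X * Z + N * N) * s)
      ≡⟨ sym (*-identityˡ _) ⟩
    1ℚ * (((X * Z + N * N) * s) * ((X * Z + N * N) * s)) ∎)

  b₁²+dac₁²≡1 : ∀ {b₁ dac₁} →
    b₁ * b₁ * ((X * Z - N * N) * (X * Z - N * N)) ≡ (N * (Z - X)) * (N * (Z - X)) →
    dac₁ * dac₁ * (((X * Z - N * N) * s) * ((X * Z - N * N) * s)) ≡ (Y * W) * (Y * W) →
    b₁ * b₁ + dac₁ * dac₁ ≡ 1ℚ
  b₁²+dac₁²≡1 {b₁} {dac₁} hb hdac = *-cancelʳ-≡ (*-≢0 Ms≢0 Ms≢0) (begin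
    (b₁ * b₁ + dac₁ * dac₁) * (((X * Z - N * N) * s) * ((X * Z - N * N) * s))
      ≡⟨ solve (N ∷ X ∷ Z ∷ s ∷ b₁ ∷ dac₁ ∷ []) ℚ-ring ⟩
    dac₁ * dac₁ * (((X * Z - N * N) * s) * ((X * Z - N * N) * s))
      + b₁ * b₁ * ((X * Z - N * N) * (X * Z - N * N)) * (s * s)
      ≡⟨ cong₂ _+_ hdac (cong (_* (s * s)) hb) ⟩
    (Y * W) * (Y * W) + (N * (Z - X)) * (N * (Z - X)) * (s * s)
      ≡⟨ YW-sum₋ ⟩
    ((X * Z - N * N) * s) * ((X * Z - N * N) * s)
      ≡⟨ sym (*-identityˡ _) ⟩
    1ℚ * (((X * Z - N * N) * s) * ((X * Z - N * N) * s)) ∎)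

  a₁²+c₁²≡dac₁² : ∀ {a₁ c₁ dac₁} →
    a₁ * a₁ * (((X * Z + N * N) * s) * ((X * Z + N * N) * s)) ≡ (Y * W) * (Y * W) →
    c₁ * c₁ * ((X * X * Z * Z - N * N * N * N) * (X * X * Z * Z - N * N * N * N))
      ≡ (2ℚ * N * Y * W) * (2ℚ * N * Y * W) →
    dac₁ * dac₁ * (((X * Z - N * N) * s) * ((X * Z - N * N) * s)) ≡ (Y * W) * (Y * W) →
    a₁ * a₁ + c₁ * c₁ ≡ dac₁ * dac₁
  a₁²+c₁²≡dac₁² {a₁} {c₁} {dac₁} ha hc hdac = *-cancelʳ-≡ (*-≢0 MPs≢0 MPs≢0) (begin
    (a₁ * a₁ + c₁ * c₁) * (((X * Z - N * N) * (X * Z + N * N) * s) * ((X * Z - N * N) * (X * Z + N * N) * s))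
      ≡⟨ solve (N ∷ X ∷ Z ∷ s ∷ a₁ ∷ c₁ ∷ []) ℚ-ring ⟩
    a₁ * a₁ * (((X * Z + N * N) * s) * ((X * Z + N * N) * s)) * ((X * Z - N * N) * (X * Z - N * N))
      + c₁ * c₁ * ((X * X * Z * Z - N * N * N * N) * (X * X * Z * Z - N * N * N * N)) * (s * s)
      ≡⟨ cong₂ _+_ (cong (_* ((X * Z - N * N) * (X * Z - N * N))) ha) (cong (_* (s * s)) hc) ⟩
    (Y * W) * (Y * W) * ((X * Z - N * N) * (X * Z - N * N)) + (2ℚ * N * Y * W) * (2ℚ * N * Y * W) * (s * s)
      ≡⟨ cong ((Y * W) * (Y * W) * ((X * Z - N * N) * (X * Z - N * N)) +_) (cong ((2ℚ * N * Y * W) * (2ℚ * N * Y * W) *_) s-sq) ⟩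
    (Y * W) * (Y * W) * ((X * Z - N * N) * (X * Z - N * N)) + (2ℚ * N * Y * W) * (2ℚ * N * Y * W) * (X * Z)
      ≡⟨ solve (N ∷ X ∷ Y ∷ Z ∷ W ∷ []) ℚ-ring ⟩
    (Y * W) * (Y * W) * ((X * Z + N * N) * (X * Z + N * N))
      ≡⟨ cong (_* ((X * Z + N * N) * (X * Z + N * N))) (sym hdac) ⟩
    dac₁ * dac₁ * (((X * Z - N * N) * s) * ((X * Z - N * N) * s)) * ((X * Z + N * N) * (X * Z + N * N))
      ≡⟨ solve (N ∷ X ∷ Z ∷ s ∷ dac₁ ∷ []) ℚ-ring ⟩
    dac₁ * dac₁ * (((X * Z - N * N) * (X * Z + N * N) * s) * ((X * Z - N * N) * (X * Z + N * N) * s)) ∎)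
    where
    MPs≢0 : (X * Z - N * N) * (X * Z + N * N) * s ≢ 0ℚ
    MPs≢0 = *-≢0 (*-≢0 XZ-N²≢0 XZ+N²≢0) s≢0

  a₁ b₁ c₁ dbc₁ dac₁ : ℚ
  a₁   = ∣ Y * W ∣ ÷' ((X * Z + N * N) * s)
  b₁   = ∣ (N * (Z - X)) ÷' (X * Z - N * N) ∣
  c₁   = ∣ q′ N X Y Z W ∣
  dbc₁ = ∣ N * (X + Z) ∣ ÷' (X * Z + N * N)
  dac₁ = ∣ (Y * W) ÷' ((X * Z - N * N) * s) ∣

  2NYW≢0 : 2ℚ * N * Y * W ≢ 0ℚ
  2NYW≢0 = *-≢0 (*-≢0 (*-≢0 2≢0 N≢0) Y≢0) W≢0

  unit-cuboid : NPC a₁ b₁ c₁ dbc₁ dac₁ 1ℚ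
  unit-cuboid = record
    { a-pos   = ÷'-pos (∣∣-pos YW≢0) (*-pos XZ+N²>0 s-pos)
    ; b-pos   = ∣÷'∣-pos (*-≢0 N≢0 Z-X≢0) XZ-N²≢0
    ; c-pos   = ∣÷'∣-pos 2NYW≢0 (X²Z²-N⁴≢0 {N} {X} {Z} XZ-N²≢0 XZ+N²≢0)
    ; dbc-pos = ÷'-pos (∣∣-pos (*-≢0 N≢0 X+Z≢0)) XZ+N²>0
    ; dac-pos = ∣÷'∣-pos YW≢0 Ms≢0
    ; ds-pos  = positive⁻¹ 1ℚ
    ; eq-bc   = proj₁ bc,s
    ; eq-ac   = a²+c²≡dac²
    ; eq-s    = proj₂ bc,s
    }
    where
    Z-X≢0 : Z - X ≢ 0ℚ
    Z-X≢0 Z-X≡0 = X≢Z (sym (p-q≡0⇒p≡q Z-X≡0))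

    ha : a₁ * a₁ * (((X * Z + N * N) * s) * ((X * Z + N * N) * s)) ≡ (Y * W) * (Y * W)
    ha = ∣∣÷'-square {Y * W} Ps≢0

    hb : b₁ * b₁ * ((X * Z - N * N) * (X * Z - N * N)) ≡ (N * (Z - X)) * (N * (Z - X))
    hb = ∣÷'∣-square {N * (Z - X)} XZ-N²≢0

    hc : c₁ * c₁ * ((X * X * Z * Z - N * N * N * N) * (X * X * Z * Z - N * N * N * N))
         ≡ (2ℚ * N * Y * W) * (2ℚ * N * Y * W)
    hc = ∣÷'∣-square {2ℚ * N * Y * W} (X²Z²-N⁴≢0 {N} {X} {Z} XZ-N²≢0 XZ+N²≢0)

    hdbc : dbc₁ * dbc₁ * ((X * Z + N * N) * (X * Z + N * N)) ≡ (N * (X + Z)) * (N * (X + Z))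
    hdbc = ∣∣÷'-square {N * (X + Z)} XZ+N²≢0

    hdac : dac₁ * dac₁ * (((X * Z - N * N) * s) * ((X * Z - N * N) * s)) ≡ (Y * W) * (Y * W)
    hdac = ∣÷'∣-square {Y * W} Ms≢0

    a²+c²≡dac² : a₁ * a₁ + c₁ * c₁ ≡ dac₁ * dac₁
    a²+c²≡dac² = a₁²+c₁²≡dac₁² {a₁} {c₁} {dac₁} ha hc hdac

    bc,s : (b₁ * b₁ + c₁ * c₁ ≡ dbc₁ * dbc₁) × (a₁ * a₁ + b₁ * b₁ + c₁ * c₁ ≡ 1ℚ * 1ℚ)
    bc,s = unit-cuboid-equations {a₁} {b₁} {c₁} {dbc₁} {dac₁}
             (a₁²+dbc₁²≡1 {a₁} {dbc₁} ha hdbc) (b₁²+dac₁²≡1 {b₁} {dac₁} hb hdac) a²+c²≡dac²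

  cuboid : ∀ d → 0ℚ < d →
    NPC (a′ N X Y Z W s d) (b′ N X Y Z W s d) (c′ N X Y Z W s d) (dbc′ N X Y Z W s d) (dac′ N X Y Z W s d) d
    × (a′ N X Y Z W s d * a′ N X Y Z W s d + b′ N X Y Z W s d * b′ N X Y Z W s d
        ≡ (1ℚ - q′ N X Y Z W * q′ N X Y Z W) * (d * d))
  cuboid d d>0 =
    subst (NPC (a₁ * d) (b₁ * d) (c₁ * d) (dbc₁ * d) (dac₁ * d)) (*-identityˡ d) (NPC-scale d unit-cuboid d>0) ,
    trans (face-diagonal {a₁} {b₁} {c₁} d (NPC.eq-s unit-cuboid)) (cong (λ t → (1ℚ - t) * (d * d)) (∣∣-sq (q′ N X Y Z W)))

-- From a cuboid to two points of a congruent number curve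

pythagorean-parameter⁺ : ∀ p q r → p * p + q * q ≡ r * r → (r + p) * (r + p) + q * q ≡ 2ℚ * r * (r + p)
pythagorean-parameter⁺ p q r p²+q²≡r² = begin
  (r + p) * (r + p) + q * q          ≡⟨ solve (p ∷ q ∷ r ∷ []) ℚ-ring ⟩
  r * r + 2ℚ * r * p + (p * p + q * q)  ≡⟨ cong (r * r + 2ℚ * r * p +_) p²+q²≡r² ⟩
  r * r + 2ℚ * r * p + r * r         ≡⟨ solve (p ∷ r ∷ []) ℚ-ring ⟩
  2ℚ * r * (r + p)                   ∎

pythagorean-parameter⁻ : ∀ p q r → p * p + q * q ≡ r * r → (r + p) * (r + p) - q * q ≡ 2ℚ * p * (r + p)
pythagorean-parameter⁻ p q r p²+q²≡r² = begin
  (r + p) * (r + p) - q * q                        ≡⟨ solve (p ∷ q ∷ r ∷ []) ℚ-ring ⟩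
  2ℚ * p * (r + p) + (r * r - (p * p + q * q))     ≡⟨ cong (λ t → 2ℚ * p * (r + p) + (r * r - t)) p²+q²≡r² ⟩
  2ℚ * p * (r + p) + (r * r - r * r)               ≡⟨ solve (p ∷ r ∷ []) ℚ-ring ⟩
  2ℚ * p * (r + p)                                 ∎

-- A, B and μ are parameters, not definitions, so that the ring solver treats them as
-- variables; FromCuboid instantiates them.
module CuboidPoints (a b c dbc dac ds A B μ : ℚ)
  (μ-def : μ ≡ 2ℚ * a * dac * B * (b + dbc))
  (A⁺ : A * A + c * c ≡ 2ℚ * dac * A)
  (A⁻ : A * A - c * c ≡ 2ℚ * a * A)
  (B⁺ : B * B + (c * ds) * (c * ds) ≡ 2ℚ * (dbc * dac) * B)
  (B⁻ : B * B - (c * ds) * (c * ds) ≡ 2ℚ * (a * b) * B)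
  (second-point-relation : (b + dbc) * (A * A * (ds * ds) - B * B) ≡ 2ℚ * a * dac * A * B)
  where

  N X Z s Y W : ℚ
  N = μ * c * (c * ds) * B
  X = μ * A * (B * B)
  Z = μ * A * ((c * ds) * (c * ds))
  s = μ * A * B * (c * ds)
  Y = μ * μ * A * (B * B)
  W = μ * (2ℚ * a * dac * B) * A * ((c * ds) * (c * ds)) * c

  s²≡XZ : s * s ≡ X * Z
  s²≡XZ = begin
    (μ * A * B * (c * ds)) * (μ * A * B * (c * ds))     ≡⟨ solve (c ∷ ds ∷ A ∷ B ∷ μ ∷ []) ℚ-ring ⟩
    (μ * A * (B * B)) * (μ * A * ((c * ds) * (c * ds))) ∎

  XZ+N²≡ : X * Z + N * N ≡ (μ * (c * ds) * B) * (μ * (c * ds) * B) * (2ℚ * dac * A)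
  XZ+N²≡ = begin
    (μ * A * (B * B)) * (μ * A * ((c * ds) * (c * ds))) + (μ * c * (c * ds) * B) * (μ * c * (c * ds) * B)
      ≡⟨ solve (c ∷ ds ∷ A ∷ B ∷ μ ∷ []) ℚ-ring ⟩
    (μ * (c * ds) * B) * (μ * (c * ds) * B) * (A * A + c * c)
      ≡⟨ cong ((μ * (c * ds) * B) * (μ * (c * ds) * B) *_) A⁺ ⟩
    (μ * (c * ds) * B) * (μ * (c * ds) * B) * (2ℚ * dac * A) ∎

  XZ-N²≡ : X * Z - N * N ≡ (μ * (c * ds) * B) * (μ * (c * ds) * B) * (2ℚ * a * A)
  XZ-N²≡ = begin
    (μ * A * (B * B)) * (μ * A * ((c * ds) * (c * ds))) - (μ * c * (c * ds) * B) * (μ * c * (c * ds) * B)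
      ≡⟨ solve (c ∷ ds ∷ A ∷ B ∷ μ ∷ []) ℚ-ring ⟩
    (μ * (c * ds) * B) * (μ * (c * ds) * B) * (A * A - c * c)
      ≡⟨ cong ((μ * (c * ds) * B) * (μ * (c * ds) * B) *_) A⁻ ⟩
    (μ * (c * ds) * B) * (μ * (c * ds) * B) * (2ℚ * a * A) ∎

  X+Z≡ : X + Z ≡ μ * A * (2ℚ * (dbc * dac) * B)
  X+Z≡ = begin
    μ * A * (B * B) + μ * A * ((c * ds) * (c * ds))  ≡⟨ solve (c ∷ ds ∷ A ∷ B ∷ μ ∷ []) ℚ-ring ⟩
    μ * A * (B * B + (c * ds) * (c * ds))            ≡⟨ cong (μ * A *_) B⁺ ⟩
    μ * A * (2ℚ * (dbc * dac) * B)                   ∎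

  X-Z≡ : X - Z ≡ μ * A * (2ℚ * (a * b) * B)
  X-Z≡ = begin
    μ * A * (B * B) - μ * A * ((c * ds) * (c * ds))  ≡⟨ solve (c ∷ ds ∷ A ∷ B ∷ μ ∷ []) ℚ-ring ⟩
    μ * A * (B * B - (c * ds) * (c * ds))            ≡⟨ cong (μ * A *_) B⁻ ⟩
    μ * A * (2ℚ * (a * b) * B)                       ∎

  A²B²-c⁴ds²≡μA : A * A * (B * B) - (c * (c * ds)) * (c * (c * ds)) ≡ μ * A
  A²B²-c⁴ds²≡μA = *-cancelʳ-≡ 2≢0 (begin
    (A * A * (B * B) - (c * (c * ds)) * (c * (c * ds))) * 2ℚ
      ≡⟨ solve (c ∷ ds ∷ A ∷ B ∷ []) ℚ-ring ⟩
    (A * A + c * c) * (B * B - (c * ds) * (c * ds)) + (A * A - c * c) * (B * B + (c * ds) * (c * ds))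
      ≡⟨ cong₂ _+_ (cong₂ _*_ A⁺ B⁻) (cong₂ _*_ A⁻ B⁺) ⟩
    (2ℚ * dac * A) * (2ℚ * (a * b) * B) + (2ℚ * a * A) * (2ℚ * (dbc * dac) * B)
      ≡⟨ solve (a ∷ b ∷ dbc ∷ dac ∷ A ∷ B ∷ []) ℚ-ring ⟩
    (2ℚ * a * dac * B * (b + dbc)) * A * 2ℚ
      ≡⟨ cong (λ t → t * A * 2ℚ) (sym μ-def) ⟩
    μ * A * 2ℚ ∎)

  X-on-curve : OnCurve N X Y
  X-on-curve = begin
    (μ * μ * A * (B * B)) * (μ * μ * A * (B * B))
      ≡⟨ solve (A ∷ B ∷ μ ∷ []) ℚ-ring ⟩
    μ * μ * μ * A * (B * B * B * B) * (μ * A)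
      ≡⟨ cong (μ * μ * μ * A * (B * B * B * B) *_) (sym A²B²-c⁴ds²≡μA) ⟩
    μ * μ * μ * A * (B * B * B * B) * (A * A * (B * B) - (c * (c * ds)) * (c * (c * ds)))
      ≡⟨ solve (c ∷ ds ∷ A ∷ B ∷ μ ∷ []) ℚ-ring ⟩
    (μ * A * (B * B)) * (μ * A * (B * B)) * (μ * A * (B * B))
      - (μ * c * (c * ds) * B) * (μ * c * (c * ds) * B) * (μ * A * (B * B)) ∎

  Z-on-curve : OnCurve N Z W
  Z-on-curve = begin
    (μ * (2ℚ * a * dac * B) * A * ((c * ds) * (c * ds)) * c) * (μ * (2ℚ * a * dac * B) * A * ((c * ds) * (c * ds)) * c)
      ≡⟨ solve (a ∷ c ∷ dac ∷ ds ∷ A ∷ B ∷ μ ∷ []) ℚ-ring ⟩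
    μ * μ * (2ℚ * a * dac * B) * A * ((c * ds) * (c * ds) * (c * ds) * (c * ds)) * (c * c) * (2ℚ * a * dac * A * B)
      ≡⟨ cong (μ * μ * (2ℚ * a * dac * B) * A * ((c * ds) * (c * ds) * (c * ds) * (c * ds)) * (c * c) *_) (sym second-point-relation) ⟩
    μ * μ * (2ℚ * a * dac * B) * A * ((c * ds) * (c * ds) * (c * ds) * (c * ds)) * (c * c)
      * ((b + dbc) * (A * A * (ds * ds) - B * B))
      ≡⟨ solve (a ∷ b ∷ c ∷ dbc ∷ dac ∷ ds ∷ A ∷ B ∷ μ ∷ []) ℚ-ring ⟩
    μ * μ * (2ℚ * a * dac * B * (b + dbc)) * A * ((c * ds) * (c * ds) * (c * ds) * (c * ds)) * (c * c)
      * (A * A * (ds * ds) - B * B)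
      ≡⟨ cong (λ t → μ * μ * t * A * ((c * ds) * (c * ds) * (c * ds) * (c * ds)) * (c * c) * (A * A * (ds * ds) - B * B))
              (sym μ-def) ⟩
    μ * μ * μ * A * ((c * ds) * (c * ds) * (c * ds) * (c * ds)) * (c * c) * (A * A * (ds * ds) - B * B)
      ≡⟨ solve (c ∷ ds ∷ A ∷ B ∷ μ ∷ []) ℚ-ring ⟩
    (μ * A * ((c * ds) * (c * ds))) * (μ * A * ((c * ds) * (c * ds))) * (μ * A * ((c * ds) * (c * ds)))
      - (μ * c * (c * ds) * B) * (μ * c * (c * ds) * B) * (μ * A * ((c * ds) * (c * ds))) ∎

  a-formula : a * ((X * Z + N * N) * s) ≡ (Y * W) * ds
  a-formula = begin
    a * ((X * Z + N * N) * s)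
      ≡⟨ cong (λ t → a * (t * s)) XZ+N²≡ ⟩
    a * ((μ * (c * ds) * B) * (μ * (c * ds) * B) * (2ℚ * dac * A) * (μ * A * B * (c * ds)))
      ≡⟨ solve (a ∷ c ∷ dac ∷ ds ∷ A ∷ B ∷ μ ∷ []) ℚ-ring ⟩
    (μ * μ * A * (B * B)) * (μ * (2ℚ * a * dac * B) * A * ((c * ds) * (c * ds)) * c) * ds ∎

  b-formula : (- b) * (X * Z - N * N) ≡ (N * (Z - X)) * ds
  b-formula = begin
    (- b) * (X * Z - N * N)
      ≡⟨ cong ((- b) *_) XZ-N²≡ ⟩
    (- b) * ((μ * (c * ds) * B) * (μ * (c * ds) * B) * (2ℚ * a * A))
      ≡⟨ solve (a ∷ b ∷ c ∷ ds ∷ A ∷ B ∷ μ ∷ []) ℚ-ring ⟩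
    (μ * c * (c * ds) * B) * (- (μ * A * (2ℚ * (a * b) * B))) * ds
      ≡⟨ cong (λ t → (μ * c * (c * ds) * B) * (- t) * ds) (sym X-Z≡) ⟩
    (μ * c * (c * ds) * B) * (- (μ * A * (B * B) - μ * A * ((c * ds) * (c * ds)))) * ds
      ≡⟨ solve (c ∷ ds ∷ A ∷ B ∷ μ ∷ []) ℚ-ring ⟩
    (μ * c * (c * ds) * B) * (μ * A * ((c * ds) * (c * ds)) - μ * A * (B * B)) * ds ∎

  c-formula : c * (X * X * Z * Z - N * N * N * N) ≡ (2ℚ * N * Y * W) * ds
  c-formula = begin
    c * (X * X * Z * Z - N * N * N * N)
      ≡⟨ cong (c *_) (difference-of-fourth-powers N X Z) ⟩
    c * ((X * Z - N * N) * (X * Z + N * N))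
      ≡⟨ cong₂ (λ u v → c * (u * v)) XZ-N²≡ XZ+N²≡ ⟩
    c * ((μ * (c * ds) * B) * (μ * (c * ds) * B) * (2ℚ * a * A) * ((μ * (c * ds) * B) * (μ * (c * ds) * B) * (2ℚ * dac * A)))
      ≡⟨ solve (a ∷ c ∷ dac ∷ ds ∷ A ∷ B ∷ μ ∷ []) ℚ-ring ⟩
    (2ℚ * (μ * c * (c * ds) * B) * (μ * μ * A * (B * B)) * (μ * (2ℚ * a * dac * B) * A * ((c * ds) * (c * ds)) * c)) * ds ∎

  dbc-formula : dbc * (X * Z + N * N) ≡ (N * (X + Z)) * ds
  dbc-formula = begin
    dbc * (X * Z + N * N)
      ≡⟨ cong (dbc *_) XZ+N²≡ ⟩
    dbc * ((μ * (c * ds) * B) * (μ * (c * ds) * B) * (2ℚ * dac * A))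
      ≡⟨ solve (c ∷ dbc ∷ dac ∷ ds ∷ A ∷ B ∷ μ ∷ []) ℚ-ring ⟩
    (μ * c * (c * ds) * B) * (μ * A * (2ℚ * (dbc * dac) * B)) * ds
      ≡⟨ cong (λ t → (μ * c * (c * ds) * B) * t * ds) (sym X+Z≡) ⟩
    (N * (X + Z)) * ds ∎

  dac-formula : dac * ((X * Z - N * N) * s) ≡ (Y * W) * ds
  dac-formula = begin
    dac * ((X * Z - N * N) * s)
      ≡⟨ cong (λ t → dac * (t * s)) XZ-N²≡ ⟩
    dac * ((μ * (c * ds) * B) * (μ * (c * ds) * B) * (2ℚ * a * A) * (μ * A * B * (c * ds)))
      ≡⟨ solve (a ∷ c ∷ dac ∷ ds ∷ A ∷ B ∷ μ ∷ []) ℚ-ring ⟩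
    (μ * μ * A * (B * B)) * (μ * (2ℚ * a * dac * B) * A * ((c * ds) * (c * ds)) * c) * ds ∎

module FromCuboid {a b c dbc dac ds : ℚ} (npc : NPC a b c dbc dac ds) where
  open NPC npc

  NPC-a²+dbc² : a * a + dbc * dbc ≡ ds * ds
  NPC-a²+dbc² = begin
    a * a + dbc * dbc          ≡⟨ cong (a * a +_) (sym eq-bc) ⟩
    a * a + (b * b + c * c)    ≡⟨ solve (a ∷ b ∷ c ∷ []) ℚ-ring ⟩
    a * a + b * b + c * c      ≡⟨ eq-s ⟩
    ds * ds                    ∎

  NPC-b²+dac² : b * b + dac * dac ≡ ds * ds
  NPC-b²+dac² = begin
    b * b + dac * dac          ≡⟨ cong (b * b +_) (sym eq-ac) ⟩
    b * b + (a * a + c * c)    ≡⟨ solve (a ∷ b ∷ c ∷ []) ℚ-ring ⟩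
    a * a + b * b + c * c      ≡⟨ eq-s ⟩
    ds * ds                    ∎

  NPC-product-triangle : (a * b) * (a * b) + (c * ds) * (c * ds) ≡ (dbc * dac) * (dbc * dac)
  NPC-product-triangle = begin
    (a * b) * (a * b) + (c * ds) * (c * ds)   ≡⟨ solve (a ∷ b ∷ c ∷ ds ∷ []) ℚ-ring ⟩
    (a * b) * (a * b) + c * c * (ds * ds)     ≡⟨ cong (λ t → (a * b) * (a * b) + c * c * t) (sym eq-s) ⟩
    (a * b) * (a * b) + c * c * (a * a + b * b + c * c)  ≡⟨ solve (a ∷ b ∷ c ∷ []) ℚ-ring ⟩
    (b * b + c * c) * (a * a + c * c)         ≡⟨ cong₂ _*_ eq-bc eq-ac ⟩
    (dbc * dbc) * (dac * dac)                 ≡⟨ solve (dbc ∷ dac ∷ []) ℚ-ring ⟩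
    (dbc * dac) * (dbc * dac)                 ∎

  second-point-relation :
    (b + dbc) * ((dac + a) * (dac + a) * (ds * ds) - (dbc * dac + a * b) * (dbc * dac + a * b))
    ≡ 2ℚ * a * dac * (dac + a) * (dbc * dac + a * b)
  second-point-relation = begin
    (b + dbc) * ((dac + a) * (dac + a) * (ds * ds) - (dbc * dac + a * b) * (dbc * dac + a * b))
      ≡⟨ solve (a ∷ b ∷ c ∷ dbc ∷ dac ∷ ds ∷ []) ℚ-ring ⟩
    (b + dbc) * (ds * ds * ((dac + a) * (dac + a) - c * c)
                 - ((dbc * dac + a * b) * (dbc * dac + a * b) - (c * ds) * (c * ds)))
      ≡⟨ cong₂ (λ u v → (b + dbc) * (ds * ds * u - v))
               (pythagorean-parameter⁻ a c dac eq-ac)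
               (pythagorean-parameter⁻ (a * b) (c * ds) (dbc * dac) NPC-product-triangle) ⟩
    (b + dbc) * (ds * ds * (2ℚ * a * (dac + a)) - 2ℚ * (a * b) * (dbc * dac + a * b))
      ≡⟨ solve (a ∷ b ∷ dbc ∷ dac ∷ ds ∷ []) ℚ-ring ⟩
    2ℚ * a * (dac * (dac + a) * (dbc * dac + a * b)
              + (dbc * dac + a * b + a * dbc) * (ds * ds - (b * b + dac * dac))
              + b * dac * (ds * ds - (a * a + dbc * dbc)))
      ≡⟨ cong₂ (λ u v → 2ℚ * a * (dac * (dac + a) * (dbc * dac + a * b)
                                  + (dbc * dac + a * b + a * dbc) * (ds * ds - u) + b * dac * (ds * ds - v)))
               NPC-b²+dac² NPC-a²+dbc² ⟩
    2ℚ * a * (dac * (dac + a) * (dbc * dac + a * b)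
              + (dbc * dac + a * b + a * dbc) * (ds * ds - ds * ds)
              + b * dac * (ds * ds - ds * ds))
      ≡⟨ solve (a ∷ b ∷ dbc ∷ dac ∷ ds ∷ []) ℚ-ring ⟩
    2ℚ * a * dac * (dac + a) * (dbc * dac + a * b) ∎

  A B μ : ℚ
  A = dac + a
  B = dbc * dac + a * b
  -- μ is chosen so that X³ − N²X and Z³ − N²Z are the squares Y² and W².
  μ = 2ℚ * a * dac * B * (b + dbc)

  open CuboidPoints a b c dbc dac ds A B μ refl
    (pythagorean-parameter⁺ a c dac eq-ac) (pythagorean-parameter⁻ a c dac eq-ac)
    (pythagorean-parameter⁺ (a * b) (c * ds) (dbc * dac) NPC-product-triangle)
    (pythagorean-parameter⁻ (a * b) (c * ds) (dbc * dac) NPC-product-triangle)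
    second-point-relation
    public

  A>0 : 0ℚ < A
  A>0 = +-pos dac-pos a-pos

  B>0 : 0ℚ < B
  B>0 = +-pos (*-pos dbc-pos dac-pos) (*-pos a-pos b-pos)

  2adacB>0 : 0ℚ < 2ℚ * a * dac * B
  2adacB>0 = *-pos (*-pos (*-pos 2>0 a-pos) dac-pos) B>0

  μ>0 : 0ℚ < μ
  μ>0 = *-pos 2adacB>0 (+-pos b-pos dbc-pos)

  cds>0 : 0ℚ < c * ds
  cds>0 = *-pos c-pos ds-pos

  μcdsB>0 : 0ℚ < μ * (c * ds) * B
  μcdsB>0 = *-pos (*-pos μ>0 cds>0) B>0

  N>0 : 0ℚ < N
  N>0 = *-pos (*-pos (*-pos μ>0 c-pos) cds>0) B>0

  X>0 : 0ℚ < X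
  X>0 = *-pos (*-pos μ>0 A>0) (*-pos B>0 B>0)

  Z>0 : 0ℚ < Z
  Z>0 = *-pos (*-pos μ>0 A>0) (*-pos cds>0 cds>0)

  s>0 : 0ℚ < s
  s>0 = *-pos (*-pos (*-pos μ>0 A>0) B>0) cds>0

  Y>0 : 0ℚ < Y
  Y>0 = *-pos (*-pos (*-pos μ>0 μ>0) A>0) (*-pos B>0 B>0)

  W>0 : 0ℚ < W
  W>0 = *-pos (*-pos (*-pos (*-pos μ>0 2adacB>0) A>0) (*-pos cds>0 cds>0)) c-pos

  XZ+N²>0 : 0ℚ < X * Z + N * N
  XZ+N²>0 = subst (0ℚ <_) (sym XZ+N²≡) (*-pos (*-pos μcdsB>0 μcdsB>0) (*-pos (*-pos 2>0 dac-pos) A>0))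

  XZ-N²>0 : 0ℚ < X * Z - N * N
  XZ-N²>0 = subst (0ℚ <_) (sym XZ-N²≡) (*-pos (*-pos μcdsB>0 μcdsB>0) (*-pos (*-pos 2>0 a-pos) A>0))

  X≢Z : X ≢ Z
  X≢Z X≡Z = pos⇒≢0 X-Z>0 (trans (cong (λ t → X - t) (sym X≡Z)) (+-inverseʳ X))
    where
    X-Z>0 : 0ℚ < X - Z
    X-Z>0 = subst (0ℚ <_) (sym X-Z≡) (*-pos (*-pos μ>0 A>0) (*-pos (*-pos 2>0 (*-pos a-pos b-pos)) B>0))

  admissible : Admissible N X Y Z W s
  admissible = record
    { N-pos    = N>0
    ; onCurve₁ = X-on-curve
    ; onCurve₂ = Z-on-curve
    ; Y≢0      = pos⇒≢0 Y>0
    ; W≢0      = pos⇒≢0 W>0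
    ; X≢Z      = X≢Z
    ; s-pos    = s>0
    ; s-sq     = s²≡XZ
    }

  ds≥0 : 0ℚ ≤ ds
  ds≥0 = <⇒≤ ds-pos

  a≡a′ : a ≡ a′ N X Y Z W s ds
  a≡a′ = sym (÷'-scale {∣ Y * W ∣} (*-≢0 (pos⇒≢0 XZ+N²>0) (pos⇒≢0 s>0))
                       (trans a-formula (cong (_* ds) (sym (pos⇒∣p∣≡p (*-pos Y>0 W>0))))))

  b≡b′ : b ≡ b′ N X Y Z W s ds
  b≡b′ = sym (trans (∣÷'∣-scale {N * (Z - X)} (pos⇒≢0 XZ-N²>0) ds≥0 b-formula)
                    (trans (∣-p∣≡∣p∣ b) (pos⇒∣p∣≡p b-pos)))

  c≡c′ : c ≡ c′ N X Y Z W s ds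
  c≡c′ = sym (trans (∣÷'∣-scale {2ℚ * N * Y * W} (X²Z²-N⁴≢0 {N} {X} {Z} (pos⇒≢0 XZ-N²>0) (pos⇒≢0 XZ+N²>0))
                                 ds≥0 c-formula)
                    (pos⇒∣p∣≡p c-pos))

  dbc≡dbc′ : dbc ≡ dbc′ N X Y Z W s ds
  dbc≡dbc′ = sym (÷'-scale {∣ N * (X + Z) ∣} (pos⇒≢0 XZ+N²>0)
                           (trans dbc-formula (cong (_* ds) (sym (pos⇒∣p∣≡p (*-pos N>0 (+-pos X>0 Z>0)))))))

  dac≡dac′ : dac ≡ dac′ N X Y Z W s ds
  dac≡dac′ = sym (trans (∣÷'∣-scale {Y * W} (*-≢0 (pos⇒≢0 XZ-N²>0) (pos⇒≢0 s>0)) ds≥0 dac-formula)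
                        (pos⇒∣p∣≡p dac-pos))

-- Perfect cuboids

square-root-pos : ∀ {r x} → 0ℚ < x → r * r ≡ x → 0ℚ < ∣ r ∣
square-root-pos {r} {x} x>0 r²≡x = ∣∣-pos λ r≡0 → pos⇒≢0 x>0 (begin
  x          ≡⟨ sym r²≡x ⟩
  r * r      ≡⟨ cong (λ t → t * t) r≡0 ⟩
  0ℚ * 0ℚ    ≡⟨ *-zeroˡ 0ℚ ⟩
  0ℚ         ∎)

PerfectCuboid⇒NPC : ∀ {a b c} → PerfectCuboid a b c → ∃ λ dbc → ∃ λ dac → ∃ λ ds → NPC a b c dbc dac ds
PerfectCuboid⇒NPC (a>0 , b>0 , c>0 , _ , (r₂ , h₂) , (r₃ , h₃) , (r₄ , h₄)) = ∣ r₂ ∣ , ∣ r₃ ∣ , ∣ r₄ ∣ , record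
  { a-pos   = a>0
  ; b-pos   = b>0
  ; c-pos   = c>0
  ; dbc-pos = square-root-pos (+-pos (*-pos b>0 b>0) (*-pos c>0 c>0)) h₂
  ; dac-pos = square-root-pos (+-pos (*-pos a>0 a>0) (*-pos c>0 c>0)) h₃
  ; ds-pos  = square-root-pos (+-pos (+-pos (*-pos a>0 a>0) (*-pos b>0 b>0)) (*-pos c>0 c>0)) h₄
  ; eq-bc   = sym (trans (∣∣-sq r₂) h₂)
  ; eq-ac   = sym (trans (∣∣-sq r₃) h₃)
  ; eq-s    = sym (trans (∣∣-sq r₄) h₄)
  }

NPC⇒PerfectCuboid : ∀ {a b c dbc dac ds} → NPC a b c dbc dac ds → IsSquare (a * a + b * b) → PerfectCuboid a b c
NPC⇒PerfectCuboid {dbc = dbc} {dac} {ds} npc dab =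
  a-pos , b-pos , c-pos , dab , (dbc , sym eq-bc) , (dac , sym eq-ac) , (ds , sym eq-s)
  where open NPC npc

cuboid-from-curve-points : ∀ N X Y Z W s → Admissible N X Y Z W s → ∀ d → 0ℚ < d →
  NPC (a′ N X Y Z W s d) (b′ N X Y Z W s d) (c′ N X Y Z W s d) (dbc′ N X Y Z W s d) (dac′ N X Y Z W s d) d
  × (a′ N X Y Z W s d * a′ N X Y Z W s d + b′ N X Y Z W s d * b′ N X Y Z W s d
      ≡ (1ℚ - q′ N X Y Z W * q′ N X Y Z W) * (d * d))
cuboid-from-curve-points _ _ _ _ _ _ adm = FromCurvePoints.cuboid adm

curve-points-from-cuboid : ∀ a b c dbc dac ds → NPC a b c dbc dac ds →
  ∃ λ N → ∃ λ X → ∃ λ Y → ∃ λ Z → ∃ λ W → ∃ λ s → ∃ λ d →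
    Admissible N X Y Z W s × 0ℚ < d ×
    a ≡ a′ N X Y Z W s d × b ≡ b′ N X Y Z W s d × c ≡ c′ N X Y Z W s d ×
    dbc ≡ dbc′ N X Y Z W s d × dac ≡ dac′ N X Y Z W s d × ds ≡ d
curve-points-from-cuboid _ _ _ _ _ ds npc =
  N , X , Y , Z , W , s , ds , admissible , NPC.ds-pos npc , a≡a′ , b≡b′ , c≡c′ , dbc≡dbc′ , dac≡dac′ , refl
  where open FromCuboid npc

∃PerfectCuboid : Set
∃PerfectCuboid = ∃ λ a → ∃ λ b → ∃ λ c → PerfectCuboid a b c

∃RationalFaceDiagonal : Set
∃RationalFaceDiagonal =
  ∃ λ N → ∃ λ X → ∃ λ Y → ∃ λ Z → ∃ λ W → ∃ λ s → ∃ λ d →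
    Admissible N X Y Z W s × 0ℚ < d ×
    (∃ λ r → 0ℚ ≤ r × r * r ≡ (1ℚ - q′ N X Y Z W * q′ N X Y Z W) * (d * d))

NPC⇒rational-face-diagonal : ∀ {a b c dbc dac ds} → NPC a b c dbc dac ds → IsSquare (a * a + b * b) →
                             ∃RationalFaceDiagonal
NPC⇒rational-face-diagonal {a} {b} {ds = ds} npc (r , r²≡a²+b²) =
  N , X , Y , Z , W , s , ds , admissible , NPC.ds-pos npc , ∣ r ∣ , 0≤∣p∣ r , (begin
    ∣ r ∣ * ∣ r ∣   ≡⟨ ∣∣-sq r ⟩
    r * r           ≡⟨ r²≡a²+b² ⟩
    a * a + b * b   ≡⟨ cong₂ (λ u v → u * u + v * v) a≡a′ b≡b′ ⟩
    a′ N X Y Z W s ds * a′ N X Y Z W s ds + b′ N X Y Z W s ds * b′ N X Y Z W s ds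
      ≡⟨ proj₂ (cuboid-from-curve-points N X Y Z W s admissible ds (NPC.ds-pos npc)) ⟩
    (1ℚ - q′ N X Y Z W * q′ N X Y Z W) * (ds * ds) ∎)
  where open FromCuboid npc

perfect-cuboid⇒rational-face-diagonal : ∃PerfectCuboid → ∃RationalFaceDiagonal
perfect-cuboid⇒rational-face-diagonal (_ , _ , _ , pc@(_ , _ , _ , dab , _)) =
  let _ , _ , _ , npc = PerfectCuboid⇒NPC pc in NPC⇒rational-face-diagonal npc dab

rational-face-diagonal⇒perfect-cuboid : ∃RationalFaceDiagonal → ∃PerfectCuboid
rational-face-diagonal⇒perfect-cuboid (N , X , Y , Z , W , s , d , adm , d>0 , r , _ , r²≡) =
  let npc , face = cuboid-from-curve-points N X Y Z W s adm d d>0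
  in a′ N X Y Z W s d , b′ N X Y Z W s d , c′ N X Y Z W s d , NPC⇒PerfectCuboid npc (r , trans r²≡ (sym face))

corollary1 :
    -- (i)
    (∀ N X Y Z W s → Admissible N X Y Z W s → ∀ d → 0ℚ < d →
      NPC (a′ N X Y Z W s d) (b′ N X Y Z W s d) (c′ N X Y Z W s d)
          (dbc′ N X Y Z W s d) (dac′ N X Y Z W s d) d
      × (a′ N X Y Z W s d * a′ N X Y Z W s d + b′ N X Y Z W s d * b′ N X Y Z W s d
          ≡ (1ℚ - q′ N X Y Z W * q′ N X Y Z W) * (d * d)))
    ×
    -- (ii)
    (∀ a b c dbc dac ds → NPC a b c dbc dac ds →
      ∃ λ N → ∃ λ X → ∃ λ Y → ∃ λ Z → ∃ λ W → ∃ λ s → ∃ λ d →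
        Admissible N X Y Z W s × 0ℚ < d ×
        a ≡ a′ N X Y Z W s d × b ≡ b′ N X Y Z W s d × c ≡ c′ N X Y Z W s d ×
        dbc ≡ dbc′ N X Y Z W s d × dac ≡ dac′ N X Y Z W s d × ds ≡ d)
    ×
    -- (iii)
    ((∃ λ a → ∃ λ b → ∃ λ c → PerfectCuboid a b c) ⇔
      (∃ λ N → ∃ λ X → ∃ λ Y → ∃ λ Z → ∃ λ W → ∃ λ s → ∃ λ d →
        Admissible N X Y Z W s × 0ℚ < d ×
        (∃ λ r → 0ℚ ≤ r × r * r ≡ (1ℚ - q′ N X Y Z W * q′ N X Y Z W) * (d * d))))
corollary1 =
  cuboid-from-curve-points ,
  curve-points-from-cuboid ,
  mk⇔ perfect-cuboid⇒rational-face-diagonal rational-face-diagonal⇒perfect-cuboid
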